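{- For $n\ge 5$, let $H_n$ be the graph with vertex set $\{v_1,\dots,v_n\}$ and edge set $\{v_iv_j : 1\le i\le n-3,\ i+1\le j\le n-1\}\cup\{v_{n-1}v_n\}$. Then $\chi_s(H_n)=n-1$.
   Context: A star coloring of a graph $G$ is a proper vertex-coloring such that no path on four vertices (as a subgraph) is colored with only two colors; $\chi_s(G)$ is the minimum number of colors in a star coloring of $G$. -}

module Defs where

open import Data.Nat using (ℕ; suc; _≤_; _∸_)
open import Data.Fin using (Fin; toℕ)
open import Data.Product using (Σ; _×_)
open import Data.Sum using (_⊎_)
open import Relation.Nullary using (¬_)
open import Relation.Binary.PropositionalEquality using (_≡_; _≢_)

Graph : ℕ → Set₁
Graph n = Fin n → Fin n → Set

-- 1-based index: vertex a : Fin n is v_(idx a).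
idx : {n : ℕ} → Fin n → ℕ
idx a = suc (toℕ a)

HEdge : (n : ℕ) → Fin n → Fin n → Set
HEdge n a b =
  (idx a ≤ n ∸ 3 × suc (idx a) ≤ idx b × idx b ≤ n ∸ 1)
  ⊎ (idx a ≡ n ∸ 1 × idx b ≡ n)

H : (n : ℕ) → Graph n
H n a b = HEdge n a b ⊎ HEdge n b a

Proper : {n : ℕ} → Graph n → (k : ℕ) → (Fin n → Fin k) → Set
Proper {n} G k c = ∀ (u v : Fin n) → G u v → c u ≢ c v

IsP4 : {n : ℕ} → Graph n → Fin n → Fin n → Fin n → Fin n → Set
IsP4 G a b c d =
  (a ≢ b × a ≢ c × a ≢ d × b ≢ c × b ≢ d × c ≢ d)
  × G a b × G b c × G c d

TwoColoured : {n k : ℕ} → (Fin n → Fin k) → Fin n → Fin n → Fin n → Fin n → Set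
TwoColoured {n} {k} col a b c d =
  Σ (Fin k) λ x → Σ (Fin k) λ y →
    ∀ (v : Fin n) → (v ≡ a ⊎ v ≡ b ⊎ v ≡ c ⊎ v ≡ d) → (col v ≡ x ⊎ col v ≡ y)

StarColouring : {n : ℕ} → Graph n → (k : ℕ) → (Fin n → Fin k) → Set
StarColouring {n} G k col =
  Proper G k col ×
  (∀ (a b c d : Fin n) → IsP4 G a b c d → ¬ TwoColoured col a b c d)

StarColourable : {n : ℕ} → Graph n → ℕ → Set
StarColourable {n} G k = Σ (Fin n → Fin k) λ col → StarColouring G k col

StarChromaticNumber : {n : ℕ} → Graph n → ℕ → Set
StarChromaticNumber G k = StarColourable G k × (∀ m → StarColourable G m → k ≤ m)

{-# OPTIONS --safe #-}
-- Colouring vᵢ by i mod (n − 1) repeats a colour only on v₁ and vₙ, which are non-adjacent and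
-- cannot both lie in the alternating colour classes of a two-coloured P4, so n − 1 colours suffice.
-- Conversely v₁, …, vₙ₋₃ together with either of vₙ₋₂, vₙ₋₁ form a clique. If a star colouring
-- separates vₙ₋₂ from vₙ₋₁, all vertices but vₙ get distinct colours. Otherwise vₙ differs in
-- colour from vₙ₋₁, hence from vₙ₋₂, and from every vᵢ with i ≤ n − 3, since vₙ vₙ₋₁ vᵢ vₙ₋₂
-- would be a two-coloured P4; so all vertices but vₙ₋₁ get distinct colours.
module Submission where

open import Defs
open import Data.Nat using (ℕ; suc; _+_; _≤_; _<_; _∸_; _%_; _<?_; s≤s; z<s; NonZero)
open import Data.Nat.DivMod using (_mod_; m<n⇒m%n≡m; n%n≡0)
open import Data.Nat.Properties
  using (<-cmp; ≤-refl; m≤n⇒m≤o+n; m+1+n≢n; <⇒≢; <-≤-trans; n≤1+n; <-trans; <-irrefl; ≤-antisym; ≤-pred; ≮⇒≥; m≤n⇒m<n∨m≡n; m<n⇒m≤1+n; m<n+m; m+n≮n; 1+n≢n; suc-injective)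
open import Data.Fin using (Fin; zero; toℕ; fromℕ<; punchIn; _≟_)
open import Data.Fin.Properties using (toℕ-injective; toℕ-fromℕ<; toℕ<n; injective⇒≤; punchIn-injective; punchInᵢ≢i)
open import Data.Product using (_×_; _,_; proj₁; proj₂)
open import Data.Sum using (_⊎_; inj₁; inj₂)
open import Data.Empty using (⊥-elim)
open import Function using (_∘_)
open import Relation.Nullary using (¬_; yes; no)
open import Relation.Binary using (tri<; tri≈; tri>)
open import Relation.Binary.PropositionalEquality using (_≡_; _≢_; refl; sym; trans; cong; subst; module ≡-Reasoning)

alternates-in-two-values : {A : Set} {x y a b c : A} →
  (a ≡ x ⊎ a ≡ y) → (b ≡ x ⊎ b ≡ y) → (c ≡ x ⊎ c ≡ y) → a ≢ b → b ≢ c → a ≡ c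
alternates-in-two-values (inj₁ a≡x) (inj₁ b≡x) _          a≢b _   = ⊥-elim (a≢b (trans a≡x (sym b≡x)))
alternates-in-two-values (inj₂ a≡y) (inj₂ b≡y) _          a≢b _   = ⊥-elim (a≢b (trans a≡y (sym b≡y)))
alternates-in-two-values (inj₁ a≡x) (inj₂ _)   (inj₁ c≡x) _   _   = trans a≡x (sym c≡x)
alternates-in-two-values (inj₂ a≡y) (inj₁ _)   (inj₂ c≡y) _   _   = trans a≡y (sym c≡y)
alternates-in-two-values (inj₁ _)   (inj₂ b≡y) (inj₂ c≡y) _   b≢c = ⊥-elim (b≢c (trans b≡y (sym c≡y)))
alternates-in-two-values (inj₂ _)   (inj₁ b≡x) (inj₁ c≡x) _   b≢c = ⊥-elim (b≢c (trans b≡x (sym c≡x)))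

mod≡⇒%≡ : ∀ {x y m} .{{_ : NonZero m}} → x mod m ≡ y mod m → x % m ≡ y % m
mod≡⇒%≡ same = trans (sym (toℕ-fromℕ< _)) (trans (cong toℕ same) (toℕ-fromℕ< _))

mod-clash : ∀ {x y m} .{{_ : NonZero m}} → x ≤ m → y ≤ m → x ≢ y → x mod m ≡ y mod m → x ≡ 0 ⊎ x ≡ m
mod-clash {x} {y} {m} x≤m y≤m x≢y same with m≤n⇒m<n∨m≡n x≤m | m≤n⇒m<n∨m≡n y≤m
... | inj₂ x≡m | _         = inj₂ x≡m
... | inj₁ x<m | inj₁ y<m  = ⊥-elim (x≢y (trans (sym (m<n⇒m%n≡m x<m)) (trans (mod≡⇒%≡ same) (m<n⇒m%n≡m y<m))))
... | inj₁ x<m | inj₂ refl = inj₁ (begin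
  x      ≡⟨ sym (m<n⇒m%n≡m x<m) ⟩
  x % m  ≡⟨ mod≡⇒%≡ same ⟩
  m % m  ≡⟨ n%n≡0 m ⟩
  0      ∎)
  where open ≡-Reasoning

toℕ-≡ : ∀ {n i} {u w : Fin n} → toℕ u ≡ i → toℕ w ≡ i → u ≡ w
toℕ-≡ u≡i w≡i = toℕ-injective (trans u≡i (sym w≡i))

toℕ-≢ : ∀ {n i j} {u w : Fin n} → toℕ u ≡ i → toℕ w ≡ j → i ≢ j → u ≢ w
toℕ-≢ u≡i w≡j i≢j u≡w = i≢j (trans (sym u≡i) (trans (cong toℕ u≡w) w≡j))

punctured-injective⇒≤ : ∀ {k m} (s : Fin (suc k)) (c : Fin (suc k) → Fin m) →
  (∀ {u w} → u ≢ s → w ≢ s → u ≢ w → c u ≢ c w) → k ≤ m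
punctured-injective⇒≤ s c distinct = injective⇒≤ {f = c ∘ punchIn s} injective
  where
  injective : ∀ {i j} → c (punchIn s i) ≡ c (punchIn s j) → i ≡ j
  injective {i} {j} eq with i ≟ j
  ... | yes i≡j = i≡j
  ... | no  i≢j = ⊥-elim (distinct (punchInᵢ≢i s i) (punchInᵢ≢i s j) (i≢j ∘ punchIn-injective s i j) eq)

alternating⇒TwoColoured : ∀ {n k} {col : Fin n → Fin k} {a b c d} →
                          col a ≡ col c → col b ≡ col d → TwoColoured col a b c d
alternating⇒TwoColoured {col = col} {a} {b} ac bd = col a , col b , λ where
  _ (inj₁ refl)                → inj₁ refl
  _ (inj₂ (inj₁ refl))         → inj₂ refl
  _ (inj₂ (inj₂ (inj₁ refl)))  → inj₁ (sym ac)
  _ (inj₂ (inj₂ (inj₂ refl)))  → inj₂ (sym bd)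

ClashesWithin : {n k : ℕ} → (Fin n → Fin k) → Fin n → Fin n → Set
ClashesWithin col s t = ∀ {u w} → u ≢ w → col u ≡ col w → u ≡ s ⊎ u ≡ t

module _ {n k : ℕ} {G : Graph n} {col : Fin n → Fin k} where

  TwoColoured⇒alternating : Proper G k col → ∀ {a b c d} → IsP4 G a b c d → TwoColoured col a b c d →
                            col a ≡ col c × col b ≡ col d
  TwoColoured⇒alternating proper (_ , ab , bc , cd) (_ , _ , two) =
      alternates-in-two-values at-a at-b at-c (proper _ _ ab) (proper _ _ bc)
    , alternates-in-two-values at-b at-c at-d (proper _ _ bc) (proper _ _ cd)
    where
    at-a = two _ (inj₁ refl)
    at-b = two _ (inj₂ (inj₁ refl))
    at-c = two _ (inj₂ (inj₂ (inj₁ refl)))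
    at-d = two _ (inj₂ (inj₂ (inj₂ refl)))

  proper-if-clashesWithin : ∀ {s t} → (∀ u → ¬ G u u) → ¬ G s t → ¬ G t s →
                            ClashesWithin col s t → Proper G k col
  proper-if-clashesWithin irreflexive ¬st ¬ts clash u w uw eq with u ≟ w
  ... | yes refl = irreflexive u uw
  ... | no  u≢w with clash u≢w eq | clash (u≢w ∘ sym) (sym eq)
  ...   | inj₁ refl | inj₁ refl = u≢w refl
  ...   | inj₁ refl | inj₂ refl = ¬st uw
  ...   | inj₂ refl | inj₁ refl = ¬ts uw
  ...   | inj₂ refl | inj₂ refl = u≢w refl

  -- The two alternating colour classes of a two-coloured P4 would put three distinct vertices into {s, t}.
  star-if-clashesWithin : ∀ {s t} → Proper G k col → ClashesWithin col s t → StarColouring G k col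
  star-if-clashesWithin proper clash =
    proper , λ a b c d p4@((a≢b , a≢c , _ , b≢c , b≢d , _) , _) two →
      let (ac , bd) = TwoColoured⇒alternating proper p4 two
      in a≢c (alternates-in-two-values (clash a≢c ac) (clash b≢d bd) (clash (a≢c ∘ sym) (sym ac)) a≢b b≢c)

H-sym : ∀ {n} {u w : Fin n} → H n u w → H n w u
H-sym (inj₁ uw) = inj₂ uw
H-sym (inj₂ wu) = inj₁ wu

HEdge-irreflexive : ∀ {n} (u : Fin n) → ¬ HEdge n u u
HEdge-irreflexive u (inj₁ (_ , u<u , _)) = <-irrefl refl u<u
HEdge-irreflexive {suc _} u (inj₂ (e₁ , e₂)) = 1+n≢n (sym (trans (sym e₁) e₂))

H-irreflexive : ∀ {n} (u : Fin n) → ¬ H n u u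
H-irreflexive u (inj₁ uu) = HEdge-irreflexive u uu
H-irreflexive u (inj₂ uu) = HEdge-irreflexive u uu

module _ (p : ℕ) where

  N : ℕ
  N = 3 + p

  vₙ₋₂ vₙ₋₁ vₙ : Fin N
  vₙ₋₂ = fromℕ< (m<n+m p {3} z<s)
  vₙ₋₁ = fromℕ< (m<n+m (suc p) {2} z<s)
  vₙ   = fromℕ< (m<n+m (suc (suc p)) {1} z<s)

  toℕ-vₙ₋₂ : toℕ vₙ₋₂ ≡ p
  toℕ-vₙ₋₂ = toℕ-fromℕ< (m<n+m p {3} z<s)

  toℕ-vₙ₋₁ : toℕ vₙ₋₁ ≡ suc p
  toℕ-vₙ₋₁ = toℕ-fromℕ< (m<n+m (suc p) {2} z<s)

  toℕ-vₙ : toℕ vₙ ≡ suc (suc p)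
  toℕ-vₙ = toℕ-fromℕ< (m<n+m (suc (suc p)) {1} z<s)

  vₙ₋₂≢vₙ₋₁ : vₙ₋₂ ≢ vₙ₋₁
  vₙ₋₂≢vₙ₋₁ = toℕ-≢ toℕ-vₙ₋₂ toℕ-vₙ₋₁ (1+n≢n ∘ sym)

  vₙ₋₂≢vₙ : vₙ₋₂ ≢ vₙ
  vₙ₋₂≢vₙ = toℕ-≢ toℕ-vₙ₋₂ toℕ-vₙ (m+1+n≢n 1 ∘ sym)

  vₙ₋₁≢vₙ : vₙ₋₁ ≢ vₙ
  vₙ₋₁≢vₙ = toℕ-≢ toℕ-vₙ₋₁ toℕ-vₙ (1+n≢n ∘ sym)

  data Position : Fin N → Set where
    inner   : ∀ {v} → toℕ v < p → Position v
    at-vₙ₋₂ : Position vₙ₋₂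
    at-vₙ₋₁ : Position vₙ₋₁
    at-vₙ   : Position vₙ

  position : ∀ v → Position v
  position v with toℕ v <? p
  ... | yes v<p = inner v<p
  ... | no  v≮p with m≤n⇒m<n∨m≡n (≮⇒≥ v≮p)
  ...   | inj₂ p≡v = subst Position (toℕ-≡ toℕ-vₙ₋₂ (sym p≡v)) at-vₙ₋₂
  ...   | inj₁ p<v with m≤n⇒m<n∨m≡n p<v
  ...     | inj₂ 1+p≡v = subst Position (toℕ-≡ toℕ-vₙ₋₁ (sym 1+p≡v)) at-vₙ₋₁
  ...     | inj₁ 1+p<v = subst Position (toℕ-≡ toℕ-vₙ (≤-antisym (≤-pred (toℕ<n v)) 1+p<v)) at-vₙ

  ≢vₙ⇒≤ : ∀ {w} → w ≢ vₙ → toℕ w ≤ suc p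
  ≢vₙ⇒≤ {w} w≢vₙ with m≤n⇒m<n∨m≡n (≤-pred (toℕ<n w))
  ... | inj₁ w<2+p = ≤-pred w<2+p
  ... | inj₂ w≡2+p = ⊥-elim (w≢vₙ (toℕ-≡ w≡2+p toℕ-vₙ))

  inner-≢ : ∀ {u w : Fin N} {i} → toℕ u < p → toℕ w ≡ i → p ≤ i → u ≢ w
  inner-≢ u<p w≡i p≤i = toℕ-≢ refl w≡i (<⇒≢ (<-≤-trans u<p p≤i))

  inner-≢vₙ : ∀ {u} → toℕ u < p → u ≢ vₙ
  inner-≢vₙ u<p = inner-≢ u<p toℕ-vₙ (m≤n⇒m≤o+n 2 ≤-refl)

  inner-adjacent : ∀ {u w} → toℕ u < p → w ≢ vₙ → u ≢ w → H N u w
  inner-adjacent {u} {w} u<p w≢vₙ u≢w with <-cmp (toℕ u) (toℕ w)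
  ... | tri< u<w _ _ = inj₁ (inj₁ (u<p , s≤s u<w , s≤s (≢vₙ⇒≤ w≢vₙ)))
  ... | tri≈ _ u≡w _ = ⊥-elim (u≢w (toℕ-injective u≡w))
  ... | tri> _ _ w<u = inj₂ (inj₁ (<-trans w<u u<p , s≤s w<u , s≤s (m<n⇒m≤1+n u<p)))

  vₙ₋₁-vₙ : H N vₙ₋₁ vₙ
  vₙ₋₁-vₙ = inj₁ (inj₂ (cong suc toℕ-vₙ₋₁ , cong suc toℕ-vₙ))

  vₙ-pendant : ∀ {u} → H N u vₙ → u ≡ vₙ₋₁
  vₙ-pendant (inj₁ (inj₁ (_ , _ , vₙ<2+p)))   = ⊥-elim (<-irrefl toℕ-vₙ vₙ<2+p)
  vₙ-pendant (inj₁ (inj₂ (1+u≡2+p , _)))      = toℕ-≡ (suc-injective 1+u≡2+p) toℕ-vₙ₋₁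
  vₙ-pendant (inj₂ (inj₁ (vₙ<p , _)))         = ⊥-elim (m+n≮n 2 p (subst (_< p) toℕ-vₙ vₙ<p))
  vₙ-pendant (inj₂ (inj₂ (1+vₙ≡2+p , _)))     = ⊥-elim (1+n≢n (trans (cong suc (sym toℕ-vₙ)) 1+vₙ≡2+p))

  colouring : Fin N → Fin (suc (suc p))
  colouring v = toℕ v mod suc (suc p)

  colouring-clashesWithin : ClashesWithin colouring zero vₙ
  colouring-clashesWithin {u} {w} u≢w same
    with mod-clash (≤-pred (toℕ<n u)) (≤-pred (toℕ<n w)) (u≢w ∘ toℕ-injective) same
  ... | inj₁ u≡0   = inj₁ (toℕ-≡ u≡0 refl)
  ... | inj₂ u≡2+p = inj₂ (toℕ-≡ u≡2+p toℕ-vₙ)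

  colouring-proper : Proper (H N) (suc (suc p)) colouring
  colouring-proper = proper-if-clashesWithin H-irreflexive zero≁vₙ (zero≁vₙ ∘ H-sym) colouring-clashesWithin
    where
    zero≁vₙ : ¬ H N zero vₙ
    zero≁vₙ = toℕ-≢ refl toℕ-vₙ₋₁ (λ ()) ∘ vₙ-pendant

  upper-bound : StarColourable (H N) (suc (suc p))
  upper-bound = colouring , star-if-clashesWithin colouring-proper colouring-clashesWithin

  module _ {m} {c : Fin N → Fin m} (star : StarColouring (H N) m c) where

    private
      proper : Proper (H N) m c
      proper = proj₁ star

    inner-colour≢vₙ : c vₙ₋₂ ≡ c vₙ₋₁ → ∀ {u} → toℕ u < p → c u ≢ c vₙ
    inner-colour≢vₙ same {u} u<p u~vₙ =
      proj₂ star vₙ vₙ₋₁ u vₙ₋₂ path (alternating⇒TwoColoured (sym u~vₙ) (sym same))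
      where
      u≢vₙ₋₁ = inner-≢ u<p toℕ-vₙ₋₁ (n≤1+n p)
      u≢vₙ₋₂ = inner-≢ u<p toℕ-vₙ₋₂ ≤-refl
      path : IsP4 (H N) vₙ vₙ₋₁ u vₙ₋₂
      path = ( vₙ₋₁≢vₙ ∘ sym , inner-≢vₙ u<p ∘ sym , vₙ₋₂≢vₙ ∘ sym , u≢vₙ₋₁ ∘ sym , vₙ₋₂≢vₙ₋₁ ∘ sym , u≢vₙ₋₂ )
             , H-sym vₙ₋₁-vₙ
             , H-sym (inner-adjacent u<p vₙ₋₁≢vₙ u≢vₙ₋₁)
             , inner-adjacent u<p vₙ₋₂≢vₙ u≢vₙ₋₂

    distinct-off-vₙ : c vₙ₋₂ ≢ c vₙ₋₁ → ∀ {u w} → u ≢ vₙ → w ≢ vₙ → u ≢ w → c u ≢ c w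
    distinct-off-vₙ differ {u} {w} u≢vₙ w≢vₙ u≢w with position u | position w
    ... | inner u<p | _         = proper u w (inner-adjacent u<p w≢vₙ u≢w)
    ... | _         | inner w<p = proper w u (inner-adjacent w<p u≢vₙ (u≢w ∘ sym)) ∘ sym
    ... | at-vₙ₋₂   | at-vₙ₋₂   = ⊥-elim (u≢w refl)
    ... | at-vₙ₋₂   | at-vₙ₋₁   = differ
    ... | at-vₙ₋₁   | at-vₙ₋₂   = differ ∘ sym
    ... | at-vₙ₋₁   | at-vₙ₋₁   = ⊥-elim (u≢w refl)
    ... | at-vₙ     | _         = ⊥-elim (u≢vₙ refl)
    ... | _         | at-vₙ     = ⊥-elim (w≢vₙ refl)

    vₙ₋₂-colour≢vₙ : c vₙ₋₂ ≡ c vₙ₋₁ → c vₙ₋₂ ≢ c vₙ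
    vₙ₋₂-colour≢vₙ same = proper vₙ₋₁ vₙ vₙ₋₁-vₙ ∘ trans (sym same)

    distinct-off-vₙ₋₁ : c vₙ₋₂ ≡ c vₙ₋₁ → ∀ {u w} → u ≢ vₙ₋₁ → w ≢ vₙ₋₁ → u ≢ w → c u ≢ c w
    distinct-off-vₙ₋₁ same {u} {w} u≢vₙ₋₁ w≢vₙ₋₁ u≢w with position u | position w
    ... | inner u<p | inner w<p = proper u w (inner-adjacent u<p (inner-≢vₙ w<p) u≢w)
    ... | inner u<p | at-vₙ₋₂   = proper u w (inner-adjacent u<p vₙ₋₂≢vₙ u≢w)
    ... | at-vₙ₋₂   | inner w<p = proper w u (inner-adjacent w<p vₙ₋₂≢vₙ (u≢w ∘ sym)) ∘ sym
    ... | inner u<p | at-vₙ     = inner-colour≢vₙ same u<p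
    ... | at-vₙ     | inner w<p = inner-colour≢vₙ same w<p ∘ sym
    ... | at-vₙ₋₂   | at-vₙ     = vₙ₋₂-colour≢vₙ same
    ... | at-vₙ     | at-vₙ₋₂   = vₙ₋₂-colour≢vₙ same ∘ sym
    ... | at-vₙ₋₂   | at-vₙ₋₂   = ⊥-elim (u≢w refl)
    ... | at-vₙ     | at-vₙ     = ⊥-elim (u≢w refl)
    ... | at-vₙ₋₁   | _         = ⊥-elim (u≢vₙ₋₁ refl)
    ... | _         | at-vₙ₋₁   = ⊥-elim (w≢vₙ₋₁ refl)

  lower-bound : ∀ m → StarColourable (H N) m → suc (suc p) ≤ m
  lower-bound m (c , star) with c vₙ₋₂ ≟ c vₙ₋₁
  ... | yes same   = punctured-injective⇒≤ vₙ₋₁ c (distinct-off-vₙ₋₁ star same)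
  ... | no  differ = punctured-injective⇒≤ vₙ c (distinct-off-vₙ star differ)

-- The argument works for every n ≥ 3; the hypothesis 5 ≤ n only serves to write n as 3 + p.
mainTheorem9 : (n : ℕ) → 5 ≤ n → StarChromaticNumber (H n) (n ∸ 1)
mainTheorem9 (suc (suc (suc p))) (s≤s (s≤s (s≤s _))) = upper-bound p , lower-bound p
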